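{- For $0<k<n$, \[D(n,k)=(k+1)D(n-1,k)+(n-k)D(n-1,k-1)+k\widetilde{D}(n-1,k)+(n-k+1)\widetilde{D}(n-1,k-1),\] \[\widetilde{D}(n,k)=(k+1)\widetilde{D}(n-1,k)+(n-k)\widetilde{D}(n-1,k-1)+kD(n-1,k)+(n-k+1)D(n-1,k-1),\] and the boundary values are $D(n,0)=1$, $\widetilde{D}(n,0)=0$, $D(n,n)=1$ if $n$ is even and $0$ if $n$ is odd, $\widetilde{D}(n,n)=0$ if $n$ is even and $1$ if $n$ is odd.
   Context: $\mathcal{B}_n$ is the group of permutations $\sigma$ of $\{ -n,\dots,n\}$ with $\sigma(-k)=-\sigma(k)$ for all $k$. For $\sigma\in\mathcal{B}_n$, $\mathrm{desc}(\sigma)$ is the number of $i\in\{0,\dots,n-1\}$ with $\sigma(i)>\sigma(i+1)$ (descends of $(0,\sigma(1),\dots,\sigma(n))$). $\mathcal{D}_n$ is the set of $\sigma\in\mathcal{B}_n$ such that $\{\sigma(1),\dots,\sigma(n)\}$ contains an even number of negative elements, and $\widetilde{\mathcal{D}}_n=\mathcal{B}_n\setminus\mathcal{D}_n$. $D(n,k)=\#\{\sigma\in\mathcal{D}_n:\mathrm{desc}(\sigma)=k\}$ and $\widetilde{D}(n,k)=\#\{\sigma\in\widetilde{\mathcal{D}}_n:\mathrm{desc}(\sigma)=k\}$, for $n\ge0$, $0\le k\le n$. -}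

module Defs where

open import Data.Bool using (Bool; true; false; if_then_else_)
open import Data.Nat using (ℕ; zero; suc; _%_; _≟_)
open import Data.Fin using (Fin; toℕ)
import Data.Fin.Properties as FinP
open import Data.Integer using (ℤ; +_; -[1+_]; _<?_)
open import Data.List using (List; []; _∷_; [_]; map; concatMap; allFin; filter; length)
open import Data.Vec using (Vec; []; _∷_; toList)
open import Data.Product using (_×_; _,_; proj₁; proj₂)
open import Relation.Nullary using (does)
open import Relation.Nullary.Decidable using (_×-dec_)
import Data.List.Relation.Unary.Unique.DecPropositional as UniqueDec

words : {A : Set} → List A → (m : ℕ) → List (Vec A m)
words xs zero    = [ [] ]
words xs (suc m) = concatMap (λ x → map (x ∷_) (words xs m)) xs

-- A signed letter (b , i) encodes the integer -(i+1) if b = true and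
-- +(i+1) if b = false; so letters range over {-n,...,-1,1,...,n}.
Letter : ℕ → Set
Letter n = Bool × Fin n

value : {n : ℕ} → Letter n → ℤ
value (true  , i) = -[1+ toℕ i ]
value (false , i) = + suc (toℕ i)

allLetters : (n : ℕ) → List (Letter n)
allLetters n = concatMap (λ b → map (b ,_) (allFin n)) (true ∷ false ∷ [])

-- An element σ of B_n is determined by the word (σ(1),...,σ(n)), which
-- is a word of signed letters whose absolute values are pairwise distinct
-- (hence a permutation of {1..n}); σ(0)=0 and σ(-k)=-σ(k).
B : (n : ℕ) → List (Vec (Letter n) n)
B n = filter (λ w → unique? (map proj₂ (toList w))) (words (allLetters n) n)
  where open UniqueDec (FinP._≟_ {n}) using (unique?)

descList : List ℤ → ℕ
descList []           = 0
descList (x ∷ [])     = 0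
descList (x ∷ y ∷ zs) = (if does (y <? x) then 1 else 0) + descList (y ∷ zs)
  where open import Data.Nat using (_+_)

desc : {n : ℕ} → Vec (Letter n) n → ℕ
desc w = descList (+ 0 ∷ map value (toList w))

negs : {n : ℕ} → Vec (Letter n) n → ℕ
negs w = length (filter (λ b → b Data.Bool.≟ true) (map proj₁ (toList w)))
  where import Data.Bool

-- D(n,k): σ ∈ D_n (even number of negatives) with desc σ = k
D : ℕ → ℕ → ℕ
D n k = length (filter (λ w → (negs w % 2 ≟ 0) ×-dec (desc w ≟ k)) (B n))

-- D̃(n,k): σ ∈ B_n ∖ D_n (odd number of negatives) with desc σ = k
D̃ : ℕ → ℕ → ℕ
D̃ n k = length (filter (λ w → (negs w % 2 ≟ 1) ×-dec (desc w ≟ k)) (B n))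

module Submission where

-- An element of B_{m+1} is obtained from a unique element l of B_m by
-- inserting one of the new letters ±(m+1) at one of the m+1 positions
-- after 0 in the word 0, σ(1), ..., σ(m).  If l has d descents, then
-- inserting +(m+1) (a new maximum) adds a descent exactly at the m-d
-- ascents, and inserting -(m+1) (a new minimum) adds one exactly at the
-- ascents and at the end, i.e. at m-d+1 positions; the negative letter
-- moves the word to the other parity class.  Summing over B_m gives the
-- recurrence, and the boundary values follow from it by induction.

open import Defs
open import Data.Nat using (ℕ; zero; suc; _+_; _*_; _∸_; _<_; _≤_; z≤n; s≤s; _%_)
  renaming (_≟_ to _≟ℕ_)
open import Data.Nat.Properties
open import Data.Nat.Tactic.RingSolver using (solve-∀)
open import Data.Bool using (Bool; true; false; not; _∧_; if_then_else_)
open import Data.Bool.Properties using (∧-zeroʳ)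
open import Data.Fin using (Fin; toℕ; fromℕ; inject₁; lower₁)
import Data.Fin.Properties as Fin
open import Data.Integer as ℤ using (ℤ; -[1+_]; ∣_∣) renaming (+_ to pos)
import Data.Integer.Properties as ℤ
open import Data.List using (List; []; _∷_; map; concatMap; length; filter; allFin; upTo; _++_)
import Data.List.Properties as List
open import Data.Vec using (Vec; []; _∷_; toList)
import Data.Vec.Properties as Vec
open import Data.List.Relation.Unary.All as All using (All; []; _∷_)
open import Data.List.Relation.Unary.All.Properties using (¬Any⇒All¬; All¬⇒¬Any)
open import Data.List.Relation.Unary.Any using (Any; here; there; any?)
open import Data.List.Relation.Unary.AllPairs using (AllPairs; []; _∷_)
open import Data.List.Relation.Unary.Unique.Propositional using (Unique)
import Data.List.Relation.Unary.Unique.Propositional.Properties as Unique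
open import Data.List.Membership.Propositional using (_∈_; _∉_; lose; find)
open import Data.List.Membership.Propositional.Properties
  using (∈-map⁻; ∈-map⁺; ∈-filter⁺; ∈-filter⁻; ∈-allFin; ∈-concatMap⁻; ∈-concatMap⁺; ∈-upTo⁺; ∈-upTo⁻)
open import Data.List.Membership.Propositional.Properties.WithK using (unique∧set⇒bag)
open import Data.List.Relation.Binary.BagAndSetEquality using (∼bag⇒↭)
open import Data.List.Relation.Binary.Permutation.Propositional as ↭ using (_↭_)
open import Data.List.Relation.Binary.Permutation.Propositional.Properties using (↭-length)
open import Data.Product using (Σ; _×_; _,_; proj₁; proj₂)
open import Data.Empty using (⊥-elim)
open import Function.Bundles using (mk⇔)
open import Relation.Nullary using (¬_; Dec; yes; no; does)
open import Relation.Nullary.Decidable using (_×-dec_; dec-true; dec-false)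
open import Relation.Binary using (DecidableEquality; tri<; tri≈; tri>)
open import Relation.Binary.PropositionalEquality

private variable
  A X Y : Set

ind : Bool → ℕ
ind b = if b then 1 else 0

count : (X → Bool) → List X → ℕ
count f []       = 0
count f (x ∷ xs) = ind (f x) + count f xs

sumOver : (X → ℕ) → List X → ℕ
sumOver f []       = 0
sumOver f (x ∷ xs) = f x + sumOver f xs

length-filter≡count : ∀ {P : X → Set} (P? : ∀ x → Dec (P x)) → ∀ xs →
  length (filter P? xs) ≡ count (λ x → does (P? x)) xs
length-filter≡count P? []       = refl
length-filter≡count P? (x ∷ xs) with does (P? x)
... | true  = cong suc (length-filter≡count P? xs)
... | false = length-filter≡count P? xs

count-map : (f : Y → Bool) (g : X → Y) → ∀ xs → count f (map g xs) ≡ count (λ x → f (g x)) xs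
count-map f g []       = refl
count-map f g (x ∷ xs) = cong (ind (f (g x)) +_) (count-map f g xs)

count-cong : {f g : X → Bool} → ∀ xs → (∀ {x} → x ∈ xs → f x ≡ g x) → count f xs ≡ count g xs
count-cong []       f≡g = refl
count-cong (x ∷ xs) f≡g = cong₂ _+_ (cong ind (f≡g (here refl))) (count-cong xs (λ p → f≡g (there p)))

sumOver-cong : {f g : X → ℕ} → ∀ xs → (∀ {x} → x ∈ xs → f x ≡ g x) → sumOver f xs ≡ sumOver g xs
sumOver-cong []       f≡g = refl
sumOver-cong (x ∷ xs) f≡g = cong₂ _+_ (f≡g (here refl)) (sumOver-cong xs (λ p → f≡g (there p)))

count-++ : (f : X → Bool) (xs ys : List X) → count f (xs ++ ys) ≡ count f xs + count f ys
count-++ f []       ys = refl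
count-++ f (x ∷ xs) ys = trans (cong (ind (f x) +_) (count-++ f xs ys)) (sym (+-assoc (ind (f x)) _ _))

count-concatMap : (f : Y → Bool) (h : X → List Y) → ∀ xs →
  count f (concatMap h xs) ≡ sumOver (λ x → count f (h x)) xs
count-concatMap f h []       = refl
count-concatMap f h (x ∷ xs) = trans (count-++ f (h x) (concatMap h xs))
                                     (cong (count f (h x) +_) (count-concatMap f h xs))

sumOver-+ : (f g : X → ℕ) → ∀ xs → sumOver (λ x → f x + g x) xs ≡ sumOver f xs + sumOver g xs
sumOver-+ f g []       = refl
sumOver-+ f g (x ∷ xs) = trans (cong (f x + g x +_) (sumOver-+ f g xs)) (interchange (f x) (g x) _ _)
  where
  interchange : ∀ a b c d → a + b + (c + d) ≡ a + c + (b + d)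
  interchange = solve-∀

sumOver-scale : (c : ℕ) (f : X → Bool) → ∀ xs → sumOver (λ x → c * ind (f x)) xs ≡ c * count f xs
sumOver-scale c f []       = sym (*-zeroʳ c)
sumOver-scale c f (x ∷ xs) = trans (cong (c * ind (f x) +_) (sumOver-scale c f xs))
                                   (sym (*-distribˡ-+ c (ind (f x)) _))

sumOver-linear₄ : (c₁ c₂ c₃ c₄ : ℕ) (f₁ f₂ f₃ f₄ : X → Bool) → ∀ xs →
  sumOver (λ x → c₁ * ind (f₁ x) + c₂ * ind (f₂ x) + c₃ * ind (f₃ x) + c₄ * ind (f₄ x)) xs
  ≡ c₁ * count f₁ xs + c₂ * count f₂ xs + c₃ * count f₃ xs + c₄ * count f₄ xs
sumOver-linear₄ {X} c₁ c₂ c₃ c₄ f₁ f₂ f₃ f₄ xs = begin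
  sumOver (λ x → t₁ x + t₂ x + t₃ x + t₄ x) xs
    ≡⟨ sumOver-+ (λ x → t₁ x + t₂ x + t₃ x) t₄ xs ⟩
  sumOver (λ x → t₁ x + t₂ x + t₃ x) xs + sumOver t₄ xs
    ≡⟨ cong (_+ sumOver t₄ xs) (sumOver-+ (λ x → t₁ x + t₂ x) t₃ xs) ⟩
  sumOver (λ x → t₁ x + t₂ x) xs + sumOver t₃ xs + sumOver t₄ xs
    ≡⟨ cong (λ s → s + sumOver t₃ xs + sumOver t₄ xs) (sumOver-+ t₁ t₂ xs) ⟩
  sumOver t₁ xs + sumOver t₂ xs + sumOver t₃ xs + sumOver t₄ xs
    ≡⟨ cong₂ _+_ (cong₂ _+_ (cong₂ _+_ (sumOver-scale c₁ f₁ xs) (sumOver-scale c₂ f₂ xs))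
                            (sumOver-scale c₃ f₃ xs)) (sumOver-scale c₄ f₄ xs) ⟩
  c₁ * count f₁ xs + c₂ * count f₂ xs + c₃ * count f₃ xs + c₄ * count f₄ xs ∎
  where
  open ≡-Reasoning
  t₁ t₂ t₃ t₄ : X → ℕ
  t₁ x = c₁ * ind (f₁ x)
  t₂ x = c₂ * ind (f₂ x)
  t₃ x = c₃ * ind (f₃ x)
  t₄ x = c₄ * ind (f₄ x)

sumOver-step : (F : ℕ → ℕ) (b : X → Bool) (d : ℕ) → ∀ xs →
  sumOver (λ j → F (d + ind (b j))) xs ≡ count (λ j → not (b j)) xs * F d + count b xs * F (suc d)
sumOver-step F b d []       = refl
sumOver-step F b d (x ∷ xs) with b x
... | true  rewrite sumOver-step F b d xs | +-comm d 1 =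
  shuffle (F d) (F (suc d)) (count (λ j → not (b j)) xs) (count b xs)
  where
  shuffle : ∀ p q r s → q + (r * p + s * q) ≡ r * p + (q + s * q)
  shuffle = solve-∀
... | false rewrite sumOver-step F b d xs | +-identityʳ d =
  shuffle (F d) (F (suc d)) (count (λ j → not (b j)) xs) (count b xs)
  where
  shuffle : ∀ p q r s → p + (r * p + s * q) ≡ (p + r * p) + s * q
  shuffle = solve-∀

count-false : (xs : List X) → count (λ _ → false) xs ≡ 0
count-false []       = refl
count-false (x ∷ xs) = count-false xs

count-not : (b : X → Bool) → ∀ xs → count (λ j → not (b j)) xs + count b xs ≡ length xs
count-not b []       = refl
count-not b (x ∷ xs) with b x
... | true  = trans (+-suc _ _) (cong suc (count-not b xs))
... | false = cong suc (count-not b xs)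

count-upTo-suc : (f : ℕ → Bool) → ∀ n → count f (upTo (suc n)) ≡ ind (f 0) + count (λ j → f (suc j)) (upTo n)
count-upTo-suc f n = cong (ind (f 0) +_)
  (trans (cong (count f) (sym (List.map-upTo suc n))) (count-map f suc (upTo n)))

count-↭ : (f : X → Bool) {xs ys : List X} → xs ↭ ys → count f xs ≡ count f ys
count-↭ f ↭.refl         = refl
count-↭ f (↭.prep x p)   = cong (ind (f x) +_) (count-↭ f p)
count-↭ f (↭.swap x y p) = trans (sym (+-assoc (ind (f x)) (ind (f y)) _))
  (trans (cong₂ _+_ (+-comm (ind (f x)) (ind (f y))) (count-↭ f p)) (+-assoc (ind (f y)) (ind (f x)) _))
count-↭ f (↭.trans p q)  = trans (count-↭ f p) (count-↭ f q)

unique-concatMap : (h : X → List Y) (xs : List X) → Unique xs → (∀ {x} → x ∈ xs → Unique (h x)) →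
  (∀ {x y z} → x ∈ xs → y ∈ xs → z ∈ h x → z ∈ h y → x ≡ y) → Unique (concatMap h xs)
unique-concatMap h []       u        uh disjoint = []
unique-concatMap h (x ∷ xs) (x∉ ∷ u) uh disjoint =
  Unique.++⁺ (uh (here refl))
             (unique-concatMap h xs u (λ p → uh (there p)) (λ p q → disjoint (there p) (there q)))
             λ (z∈hx , z∈rest) →
               let (y , y∈xs , z∈hy) = find (∈-concatMap⁻ h z∈rest)
               in All.lookup x∉ y∈xs (disjoint (here refl) (there y∈xs) z∈hx z∈hy)

count-same-elements : (f : X → Bool) {xs ys : List X} → Unique xs → Unique ys →
  (∀ {z} → z ∈ xs → z ∈ ys) → (∀ {z} → z ∈ ys → z ∈ xs) → count f xs ≡ count f ys
count-same-elements f uxs uys xs⊆ys ys⊆xs =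
  count-↭ f (∼bag⇒↭ (unique∧set⇒bag uxs uys (mk⇔ xs⊆ys ys⊆xs)))

length-mono-⊆ : DecidableEquality A → {xs ys : List A} → Unique xs → Unique ys →
  (∀ {z} → z ∈ xs → z ∈ ys) → length xs ≤ length ys
length-mono-⊆ _≟_ {xs} {ys} uxs uys xs⊆ys = begin
  length xs                 ≡⟨ ↭-length (∼bag⇒↭ (unique∧set⇒bag uxs (Unique.filter⁺ (_∈? xs) uys)
                                                   (mk⇔ to from))) ⟩
  length (filter (_∈? xs) ys) ≤⟨ List.length-filter (_∈? xs) ys ⟩
  length ys                 ∎
  where
  open ≤-Reasoning
  open import Data.List.Membership.DecPropositional _≟_ using (_∈?_)
  to : ∀ {z} → z ∈ xs → z ∈ filter (_∈? xs) ys
  to z∈xs = ∈-filter⁺ (_∈? xs) {xs = ys} (xs⊆ys z∈xs) z∈xs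
  from : ∀ {z} → z ∈ filter (_∈? xs) ys → z ∈ xs
  from z∈ = proj₂ (∈-filter⁻ (_∈? xs) {xs = ys} z∈)

-- insert xs j y puts y at position j of xs (at the end if j ≥ length xs).
-- Inserting the new largest absolute value n+1 into a signed permutation
-- of size n is how B_{n+1} is built from B_n.
insert : List X → ℕ → X → List X
insert xs       zero    y = y ∷ xs
insert []       (suc j) y = y ∷ []
insert (x ∷ xs) (suc j) y = x ∷ insert xs j y

map-insert : (f : X → Y) (xs : List X) (j : ℕ) (y : X) → map f (insert xs j y) ≡ insert (map f xs) j (f y)
map-insert f xs       zero    y = refl
map-insert f []       (suc j) y = refl
map-insert f (x ∷ xs) (suc j) y = cong (f x ∷_) (map-insert f xs j y)

length-insert : (xs : List X) (j : ℕ) (y : X) → length (insert xs j y) ≡ suc (length xs)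
length-insert xs       zero    y = refl
length-insert []       (suc j) y = refl
length-insert (x ∷ xs) (suc j) y = cong suc (length-insert xs j y)

count-insert : (f : X → Bool) (xs : List X) (j : ℕ) (y : X) → count f (insert xs j y) ≡ ind (f y) + count f xs
count-insert f xs       zero    y = refl
count-insert f []       (suc j) y = refl
count-insert f (x ∷ xs) (suc j) y = trans (cong (ind (f x) +_) (count-insert f xs j y))
  (trans (sym (+-assoc (ind (f x)) _ _))
  (trans (cong (_+ count f xs) (+-comm (ind (f x)) _)) (+-assoc (ind (f y)) _ _)))

All-insert⁺ : {P : X → Set} {y : X} (xs : List X) (j : ℕ) → All P xs → P y → All P (insert xs j y)
All-insert⁺ xs       zero    all py = py ∷ all
All-insert⁺ []       (suc j) all py = py ∷ []
All-insert⁺ (x ∷ xs) (suc j) (px ∷ all) py = px ∷ All-insert⁺ xs j all py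

All-insert⁻ : {P : X → Set} {y : X} (xs : List X) (j : ℕ) → All P (insert xs j y) → All P xs × P y
All-insert⁻ xs       zero    (py ∷ all) = all , py
All-insert⁻ []       (suc j) (py ∷ []) = [] , py
All-insert⁻ (x ∷ xs) (suc j) (px ∷ all) = let (all′ , py) = All-insert⁻ xs j all in (px ∷ all′) , py

unique-insert⁺ : {y : X} (xs : List X) (j : ℕ) → Unique xs → y ∉ xs → Unique (insert xs j y)
unique-insert⁺ xs       zero    u y∉ = ¬Any⇒All¬ xs y∉ ∷ u
unique-insert⁺ []       (suc j) u y∉ = [] ∷ []
unique-insert⁺ (x ∷ xs) (suc j) (x∉ ∷ u) y∉ =
  All-insert⁺ xs j x∉ (λ x≡y → y∉ (here (sym x≡y))) ∷ unique-insert⁺ xs j u (λ p → y∉ (there p))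

unique-insert⁻ : {y : X} (xs : List X) (j : ℕ) → Unique (insert xs j y) → Unique xs × y ∉ xs
unique-insert⁻ xs       zero    (y∉ ∷ u) = u , All¬⇒¬Any y∉
unique-insert⁻ []       (suc j) u        = [] , (λ ())
unique-insert⁻ (x ∷ xs) (suc j) (x∉ ∷ u) =
  let (u′ , y∉) = unique-insert⁻ xs j u
      (x∉′ , x≢y) = All-insert⁻ xs j x∉
  in (x∉′ ∷ u′) , λ { (here y≡x) → x≢y (sym y≡x) ; (there p) → y∉ p }

insert-decompose : {P : X → Set} {xs : List X} → Any P xs →
  Σ ℕ λ j → Σ X λ y → Σ (List X) λ xs′ → xs ≡ insert xs′ j y × P y × j ≤ length xs′
insert-decompose (here {x = x} {xs = xs} px) = 0 , x , xs , refl , px , z≤n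
insert-decompose (there {x = x} p) with insert-decompose p
... | j , y , xs′ , refl , py , j≤ = suc j , y , x ∷ xs′ , refl , py , s≤s j≤

insert-injectiveʳ : (xs : List X) (j : ℕ) {y y′ : X} → insert xs j y ≡ insert xs j y′ → y ≡ y′
insert-injectiveʳ xs       zero    refl = refl
insert-injectiveʳ []       (suc j) refl = refl
insert-injectiveʳ (x ∷ xs) (suc j) eq   = insert-injectiveʳ xs j (List.∷-injectiveʳ eq)

insert-injective : (Q : X → Set) (xs xs′ : List X) (j j′ : ℕ) {y y′ : X} → Q y → Q y′ →
  All (λ z → ¬ Q z) xs → All (λ z → ¬ Q z) xs′ → j ≤ length xs → j′ ≤ length xs′ →
  insert xs j y ≡ insert xs′ j′ y′ → xs ≡ xs′ × j ≡ j′
insert-injective Q xs xs′ zero zero qy qy′ _ _ _ _ refl = refl , refl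
insert-injective Q xs (x′ ∷ xs′) zero (suc j′) qy qy′ _ (¬qx′ ∷ _) _ _ refl = ⊥-elim (¬qx′ qy)
insert-injective Q (x ∷ xs) xs′ (suc j) zero qy qy′ (¬qx ∷ _) _ _ _ refl = ⊥-elim (¬qx qy′)
insert-injective Q (x ∷ xs) (x′ ∷ xs′) (suc j) (suc j′) qy qy′ (_ ∷ ¬q) (_ ∷ ¬q′) (s≤s j≤) (s≤s j′≤) eq =
  let (xs≡ , j≡) = insert-injective Q xs xs′ j j′ qy qy′ ¬q ¬q′ j≤ j′≤ (List.∷-injectiveʳ eq)
  in cong₂ (λ a as → a ∷ as) (List.∷-injectiveˡ eq) xs≡ , cong suc j≡

ascentAt : List ℤ → ℕ → Bool
ascentAt (x ∷ z ∷ zs) zero    = does (x ℤ.<? z)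
ascentAt (x ∷ z ∷ zs) (suc j) = ascentAt (z ∷ zs) j
ascentAt _            _       = false

ascentOrEndAt : List ℤ → ℕ → Bool
ascentOrEndAt []           _       = false
ascentOrEndAt (x ∷ [])     _       = true
ascentOrEndAt (x ∷ z ∷ zs) zero    = does (x ℤ.<? z)
ascentOrEndAt (x ∷ z ∷ zs) (suc j) = ascentOrEndAt (z ∷ zs) j

descent+ascent≡1 : ∀ x z → x ≢ z → ind (does (z ℤ.<? x)) + ind (does (x ℤ.<? z)) ≡ 1
descent+ascent≡1 x z x≢z with z ℤ.<? x | x ℤ.<? z
... | yes z<x | yes x<z = ⊥-elim (ℤ.<-asym z<x x<z)
... | yes _   | no _    = refl
... | no _    | yes _   = refl
... | no z≮x  | no x≮z with ℤ.<-cmp x z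
...   | tri< x<z _   _   = ⊥-elim (x≮z x<z)
...   | tri≈ _   x≡z _   = ⊥-elim (x≢z x≡z)
...   | tri> _   _   z<x = ⊥-elim (z≮x z<x)

-- Bookkeeping for replacing a pair (x, z), which contributes b descents
-- and a ascents with a + b = 1, by two pairs contributing 0 and 1 (or 1
-- and 0) descents, in front of a tail with D descents.
replace-pair : ∀ a b D → b + a ≡ 1 → 0 + (1 + D) ≡ b + D + a
replace-pair a b D b+a≡1 = trans (cong (_+ D) (sym b+a≡1)) (shuffle a b D)
  where
  shuffle : ∀ a b D → b + a + D ≡ b + D + a
  shuffle = solve-∀

descents-insert-max : ∀ x xs y j → All (ℤ._< y) (x ∷ xs) → Unique (x ∷ xs) →
  descList (insert (x ∷ xs) (suc j) y) ≡ descList (x ∷ xs) + ind (ascentAt (x ∷ xs) j)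
descents-insert-max x [] y zero (x<y ∷ _) _ rewrite dec-false (y ℤ.<? x) (ℤ.<-asym x<y) = refl
descents-insert-max x [] y (suc j) (x<y ∷ _) _ rewrite dec-false (y ℤ.<? x) (ℤ.<-asym x<y) = refl
descents-insert-max x (z ∷ zs) y zero (x<y ∷ z<y ∷ _) ((x≢z ∷ _) ∷ _)
  rewrite dec-false (y ℤ.<? x) (ℤ.<-asym x<y) | dec-true (z ℤ.<? y) z<y =
  replace-pair (ind (does (x ℤ.<? z))) (ind (does (z ℤ.<? x))) (descList (z ∷ zs)) (descent+ascent≡1 x z x≢z)
descents-insert-max x (z ∷ zs) y (suc j) (_ ∷ <y) (_ ∷ u) =
  trans (cong (ind (does (z ℤ.<? x)) +_) (descents-insert-max z zs y j <y u))
        (sym (+-assoc (ind (does (z ℤ.<? x))) _ _))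

descents-insert-min : ∀ x xs y j → All (y ℤ.<_) (x ∷ xs) → Unique (x ∷ xs) →
  descList (insert (x ∷ xs) (suc j) y) ≡ descList (x ∷ xs) + ind (ascentOrEndAt (x ∷ xs) j)
descents-insert-min x [] y zero (y<x ∷ _) _ rewrite dec-true (y ℤ.<? x) y<x = refl
descents-insert-min x [] y (suc j) (y<x ∷ _) _ rewrite dec-true (y ℤ.<? x) y<x = refl
descents-insert-min x (z ∷ zs) y zero (y<x ∷ y<z ∷ _) ((x≢z ∷ _) ∷ _)
  rewrite dec-true (y ℤ.<? x) y<x | dec-false (z ℤ.<? y) (ℤ.<-asym y<z) =
  trans (cong (1 +_) (sym (+-identityˡ (descList (z ∷ zs)))))
        (replace-pair (ind (does (x ℤ.<? z))) (ind (does (z ℤ.<? x))) (descList (z ∷ zs)) (descent+ascent≡1 x z x≢z))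
descents-insert-min x (z ∷ zs) y (suc j) (_ ∷ y<) (_ ∷ u) =
  trans (cong (ind (does (z ℤ.<? x)) +_) (descents-insert-min z zs y j y< u))
        (sym (+-assoc (ind (does (z ℤ.<? x))) _ _))

ascents+descents : ∀ x xs → Unique (x ∷ xs) →
  count (ascentAt (x ∷ xs)) (upTo (suc (length xs))) + descList (x ∷ xs) ≡ length xs
ascents+descents x []       _ = refl
ascents+descents x (z ∷ zs) ((x≢z ∷ _) ∷ u) = begin
  count (ascentAt (x ∷ z ∷ zs)) (upTo (suc (suc n))) + descList (x ∷ z ∷ zs)
    ≡⟨ cong (_+ descList (x ∷ z ∷ zs)) (count-upTo-suc (ascentAt (x ∷ z ∷ zs)) (suc n)) ⟩
  asc + count (ascentAt (z ∷ zs)) (upTo (suc n)) + (dsc + descList (z ∷ zs))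
    ≡⟨ interchange asc (count (ascentAt (z ∷ zs)) (upTo (suc n))) dsc (descList (z ∷ zs)) ⟩
  (dsc + asc) + (count (ascentAt (z ∷ zs)) (upTo (suc n)) + descList (z ∷ zs))
    ≡⟨ cong₂ _+_ (descent+ascent≡1 x z x≢z) (ascents+descents z zs u) ⟩
  suc n ∎
  where
  open ≡-Reasoning
  n asc dsc : ℕ
  n   = length zs
  asc = ind (does (x ℤ.<? z))
  dsc = ind (does (z ℤ.<? x))
  interchange : ∀ a b c d → a + b + (c + d) ≡ (c + a) + (b + d)
  interchange = solve-∀

-- The last position is the only one distinguishing ascentOrEndAt from ascentAt.
ascentOrEnd-count : ∀ x xs →
  count (ascentOrEndAt (x ∷ xs)) (upTo (suc (length xs)))
    ≡ suc (count (ascentAt (x ∷ xs)) (upTo (suc (length xs))))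
ascentOrEnd-count x []       = refl
ascentOrEnd-count x (z ∷ zs) = begin
  count (ascentOrEndAt (x ∷ z ∷ zs)) (upTo (suc (suc n)))
    ≡⟨ count-upTo-suc (ascentOrEndAt (x ∷ z ∷ zs)) (suc n) ⟩
  asc + count (ascentOrEndAt (z ∷ zs)) (upTo (suc n))
    ≡⟨ cong (asc +_) (ascentOrEnd-count z zs) ⟩
  asc + suc (count (ascentAt (z ∷ zs)) (upTo (suc n)))
    ≡⟨ +-suc asc _ ⟩
  suc (asc + count (ascentAt (z ∷ zs)) (upTo (suc n)))
    ≡⟨ cong suc (sym (count-upTo-suc (ascentAt (x ∷ z ∷ zs)) (suc n))) ⟩
  suc (count (ascentAt (x ∷ z ∷ zs)) (upTo (suc (suc n)))) ∎
  where
  open ≡-Reasoning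
  n asc : ℕ
  n   = length zs
  asc = ind (does (x ℤ.<? z))

record InsertionProfile (L : List ℤ) (n d : ℕ) : Set where
  field
    max-keeps  : count (λ j → not (ascentAt L j)) (upTo (suc n)) ≡ suc d
    max-raises : count (ascentAt L) (upTo (suc n)) ≡ n ∸ d
    min-keeps  : count (λ j → not (ascentOrEndAt L j)) (upTo (suc n)) ≡ d
    min-raises : count (ascentOrEndAt L) (upTo (suc n)) ≡ suc (n ∸ d)

-- The profile follows from ascents + descents = n and the extra end position.
insertionProfile : ∀ x xs → Unique (x ∷ xs) → InsertionProfile (x ∷ xs) (length xs) (descList (x ∷ xs))
insertionProfile x xs u = record
  { max-keeps  = +-cancelʳ-≡ asc notAsc (suc d) (begin
      notAsc + asc       ≡⟨ count-not (ascentAt L) P ⟩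
      length P           ≡⟨ length-P ⟩
      suc d + asc        ∎)
  ; max-raises = asc≡n∸d
  ; min-keeps  = +-cancelʳ-≡ (suc asc) notAoe d (begin
      notAoe + suc asc   ≡⟨ cong (notAoe +_) (sym aoe≡1+asc) ⟩
      notAoe + aoe       ≡⟨ count-not (ascentOrEndAt L) P ⟩
      length P           ≡⟨ length-P ⟩
      suc d + asc        ≡⟨ sym (+-suc d asc) ⟩
      d + suc asc        ∎)
  ; min-raises = trans aoe≡1+asc (cong suc asc≡n∸d)
  }
  where
  open ≡-Reasoning
  L : List ℤ
  L = x ∷ xs
  n d : ℕ
  n = length xs
  d = descList L
  P : List ℕ
  P = upTo (suc n)
  asc notAsc aoe notAoe : ℕ
  asc    = count (ascentAt L) P
  notAsc = count (λ j → not (ascentAt L j)) P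
  aoe    = count (ascentOrEndAt L) P
  notAoe = count (λ j → not (ascentOrEndAt L j)) P
  asc+d≡n : asc + d ≡ n
  asc+d≡n = ascents+descents x xs u
  length-P : length P ≡ suc d + asc
  length-P = trans (List.length-upTo (suc n)) (cong suc (trans (sym asc+d≡n) (+-comm asc d)))
  asc≡n∸d : asc ≡ n ∸ d
  asc≡n∸d = trans (sym (m+n∸n≡m asc d)) (cong (_∸ d) asc+d≡n)
  aoe≡1+asc : aoe ≡ suc asc
  aoe≡1+asc = ascentOrEnd-count x xs

wordOf : ∀ {n k} → Vec (Letter n) k → List ℤ
wordOf w = map value (toList w)

signedWords : ℕ → List (List ℤ)
signedWords n = map wordOf (B n)

isNeg : ℤ → Bool
isNeg (pos _)  = false
isNeg -[1+ _ ] = true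

negatives : List ℤ → ℕ
negatives = count isNeg

IsLetter : ℕ → ℤ → Set
IsLetter n x = Σ (Letter n) λ a → value a ≡ x

IsSignedPerm : ℕ → List ℤ → Set
IsSignedPerm n l = length l ≡ n × All (IsLetter n) l × Unique (map ∣_∣ l)

negs≡negatives : ∀ {n} (w : Vec (Letter n) n) → negs w ≡ negatives (wordOf w)
negs≡negatives w = begin
  negs w
    ≡⟨ length-filter≡count (λ b → b Bool.≟ true) (map proj₁ (toList w)) ⟩
  count (λ b → does (b Bool.≟ true)) (map proj₁ (toList w))
    ≡⟨ count-map _ proj₁ (toList w) ⟩
  count (λ a → does (proj₁ a Bool.≟ true)) (toList w)
    ≡⟨ count-cong (toList w) (λ { {true , _} _ → refl ; {false , _} _ → refl }) ⟩
  count (λ a → isNeg (value a)) (toList w)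
    ≡⟨ count-map isNeg value (toList w) ⟨
  negatives (wordOf w) ∎
  where
  open ≡-Reasoning
  import Data.Bool as Bool

abs-value : ∀ {n} (a : Letter n) → ∣ value a ∣ ≡ suc (toℕ (proj₂ a))
abs-value (true  , i) = refl
abs-value (false , i) = refl

abs-wordOf : ∀ {n k} (w : Vec (Letter n) k) → map ∣_∣ (wordOf w) ≡ map (λ i → suc (toℕ i)) (map proj₂ (toList w))
abs-wordOf []      = refl
abs-wordOf (a ∷ w) = cong₂ (λ x xs → x ∷ xs) (abs-value a) (abs-wordOf w)

suc-toℕ-injective : ∀ {n} {i j : Fin n} → suc (toℕ i) ≡ suc (toℕ j) → i ≡ j
suc-toℕ-injective eq = Fin.toℕ-injective (suc-injective eq)

value-injective : ∀ {n} {a b : Letter n} → value a ≡ value b → a ≡ b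
value-injective {a = true  , i} {true  , j} eq = cong (true ,_) (Fin.toℕ-injective (ℤ.-[1+-injective eq))
value-injective {a = false , i} {false , j} eq = cong (false ,_) (suc-toℕ-injective (ℤ.+-injective eq))
value-injective {a = true  , i} {false , j} ()
value-injective {a = false , i} {true  , j} ()

wordOf-injective : ∀ {n k} {v w : Vec (Letter n) k} → wordOf v ≡ wordOf w → v ≡ w
wordOf-injective {v = []}    {[]}    eq = refl
wordOf-injective {v = a ∷ v} {b ∷ w} eq =
  cong₂ _∷_ (value-injective (List.∷-injectiveˡ eq)) (wordOf-injective (List.∷-injectiveʳ eq))

words-complete : (xs : List A) → (∀ a → a ∈ xs) → ∀ {k} (v : Vec A k) → v ∈ words xs k
words-complete xs all [] = here refl
words-complete xs all (a ∷ v) =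
  ∈-concatMap⁺ (λ x → map (x ∷_) (words xs _)) (lose (all a) (∈-map⁺ (a ∷_) (words-complete xs all v)))

words-unique : (xs : List A) → Unique xs → ∀ k → Unique (words xs k)
words-unique xs u zero    = [] ∷ []
words-unique xs u (suc k) = unique-concatMap (λ x → map (x ∷_) (words xs k)) xs u
  (λ _ → Unique.map⁺ Vec.∷-injectiveʳ (words-unique xs u k))
  (λ _ _ z∈ z∈′ → let (_ , _ , eq) = ∈-map⁻ _ z∈ ; (_ , _ , eq′) = ∈-map⁻ _ z∈′
                  in Vec.∷-injectiveˡ (trans (sym eq) eq′))

allLetters-complete : ∀ {n} (a : Letter n) → a ∈ allLetters n
allLetters-complete {n} (b , i) = ∈-concatMap⁺ (λ b → map (b ,_) (allFin n)) (lose (sign∈ b) (∈-map⁺ (b ,_) (∈-allFin i)))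
  where
  sign∈ : ∀ b → b ∈ true ∷ false ∷ []
  sign∈ true  = here refl
  sign∈ false = there (here refl)

allLetters-unique : ∀ n → Unique (allLetters n)
allLetters-unique n = unique-concatMap (λ b → map (b ,_) (allFin n)) (true ∷ false ∷ [])
  (((λ ()) ∷ []) ∷ [] ∷ [])
  (λ _ → Unique.map⁺ (cong proj₂) (Unique.allFin⁺ n))
  (λ _ _ z∈ z∈′ → let (_ , _ , eq) = ∈-map⁻ _ z∈ ; (_ , _ , eq′) = ∈-map⁻ _ z∈′
                  in cong proj₁ (trans (sym eq) eq′))

signedWords-unique : ∀ n → Unique (signedWords n)
signedWords-unique n =
  Unique.map⁺ wordOf-injective (Unique.filter⁺ _ (words-unique (allLetters n) (allLetters-unique n) n))

isLetter-wordOf : ∀ {n k} (w : Vec (Letter n) k) → All (IsLetter n) (wordOf w)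
isLetter-wordOf []      = []
isLetter-wordOf (a ∷ w) = (a , refl) ∷ isLetter-wordOf w

signedWords-sound : ∀ n {l} → l ∈ signedWords n → IsSignedPerm n l
signedWords-sound n l∈ with ∈-map⁻ wordOf l∈
... | w , w∈ , refl =
  trans (List.length-map value (toList w)) (Vec.length-toList w) ,
  isLetter-wordOf w ,
  subst Unique (sym (abs-wordOf w)) (Unique.map⁺ suc-toℕ-injective
    (proj₂ (∈-filter⁻ _ {xs = words (allLetters n) n} w∈)))

signedWords-complete : ∀ n {l} → IsSignedPerm n l → l ∈ signedWords n
signedWords-complete .(length l) {l} (refl , letters , u) =
  subst (_∈ signedWords (length l)) (wordOf-toVec l letters)
    (∈-map⁺ wordOf (∈-filter⁺ _ (words-complete _ allLetters-complete (toVec l letters)) distinct))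
  where
  toVec : ∀ {n} (l : List ℤ) → All (IsLetter n) l → Vec (Letter n) (length l)
  toVec []      []                  = []
  toVec (_ ∷ l) ((a , _) ∷ letters) = a ∷ toVec l letters
  wordOf-toVec : ∀ {n} (l : List ℤ) (letters : All (IsLetter n) l) → wordOf (toVec l letters) ≡ l
  wordOf-toVec []      []                     = refl
  wordOf-toVec (_ ∷ l) ((a , refl) ∷ letters) = cong (value a ∷_) (wordOf-toVec l letters)
  distinct : Unique (map proj₂ (toList (toVec l letters)))
  distinct = Unique.map⁻ (subst Unique (abs-wordOf (toVec l letters))
               (subst (λ l′ → Unique (map ∣_∣ l′)) (sym (wordOf-toVec l letters)) u))

isLetter-suc : ∀ {m x} → IsLetter m x → IsLetter (suc m) x
isLetter-suc ((true  , i) , refl) = (true  , inject₁ i) , cong -[1+_] (Fin.toℕ-inject₁ i)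
isLetter-suc ((false , i) , refl) = (false , inject₁ i) , cong (λ t → pos (suc t)) (Fin.toℕ-inject₁ i)

isLetter-pred : ∀ {m x} → IsLetter (suc m) x → ∣ x ∣ ≢ suc m → IsLetter m x
isLetter-pred {m} ((b , i) , refl) ∣x∣≢ = (b , lower₁ i m≢i) , same-value b
  where
  m≢i : m ≢ toℕ i
  m≢i eq = ∣x∣≢ (trans (abs-value (b , i)) (cong suc (sym eq)))
  same-value : ∀ b → value (b , lower₁ i m≢i) ≡ value (b , i)
  same-value true  = cong -[1+_] (Fin.toℕ-lower₁ i m≢i)
  same-value false = cong (λ t → pos (suc t)) (Fin.toℕ-lower₁ i m≢i)

isLetter-abs≤ : ∀ {m x} → IsLetter m x → ∣ x ∣ ≤ m
isLetter-abs≤ {m} (a , refl) = subst (_≤ m) (sym (abs-value a)) (Fin.toℕ<n (proj₂ a))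

isLetter-<top : ∀ {m x} → IsLetter m x → x ℤ.< pos (suc m)
isLetter-<top ((true  , i) , refl) = ℤ.-<+
isLetter-<top ((false , i) , refl) = ℤ.+<+ (s≤s (Fin.toℕ<n i))

isLetter->bottom : ∀ {m x} → IsLetter m x → -[1+ m ] ℤ.< x
isLetter->bottom ((true  , i) , refl) = ℤ.-<- (Fin.toℕ<n i)
isLetter->bottom ((false , i) , refl) = ℤ.-<+

isLetter-≢0 : ∀ {m x} → IsLetter m x → pos 0 ≢ x
isLetter-≢0 ((true  , i) , refl) ()
isLetter-≢0 ((false , i) , refl) ()

newLetters : ℕ → List ℤ
newLetters m = pos (suc m) ∷ -[1+ m ] ∷ []

newLetters-unique : ∀ m → Unique (newLetters m)
newLetters-unique m = ((λ ()) ∷ []) ∷ [] ∷ []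

isLetter-new : ∀ m {s} → s ∈ newLetters m → IsLetter (suc m) s
isLetter-new m (here refl)         = (false , fromℕ m) , cong (λ t → pos (suc t)) (Fin.toℕ-fromℕ m)
isLetter-new m (there (here refl)) = (true  , fromℕ m) , cong -[1+_] (Fin.toℕ-fromℕ m)

abs-new : ∀ m {s} → s ∈ newLetters m → ∣ s ∣ ≡ suc m
abs-new m (here refl)         = refl
abs-new m (there (here refl)) = refl

abs≡suc⇒new : ∀ m {x} → ∣ x ∣ ≡ suc m → x ∈ newLetters m
abs≡suc⇒new m {pos _}  eq = here (cong pos eq)
abs≡suc⇒new m { -[1+ _ ]} eq = there (here (cong -[1+_] (suc-injective eq)))

no-new-letter : ∀ {m l} → IsSignedPerm m l → All (λ x → ¬ (∣ x ∣ ≡ suc m)) l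
no-new-letter (_ , letters , _) = All.map (λ ok eq → <-irrefl refl (subst (_≤ _) eq (isLetter-abs≤ ok))) letters

unique-with-0 : ∀ {m l} → IsSignedPerm m l → Unique (pos 0 ∷ l)
unique-with-0 (_ , letters , u) = All.map isLetter-≢0 letters ∷ Unique.map⁻ u

insert-new-signedPerm : ∀ m {l} j {s} → IsSignedPerm m l → s ∈ newLetters m → IsSignedPerm (suc m) (insert l j s)
insert-new-signedPerm m {l} j {s} (len , letters , u) s∈ =
  trans (length-insert l j s) (cong suc len) ,
  All-insert⁺ l j (All.map isLetter-suc letters) (isLetter-new m s∈) ,
  subst Unique (sym (map-insert ∣_∣ l j s)) (unique-insert⁺ (map ∣_∣ l) j u ∣s∣∉)
  where
  ∣s∣∉ : ∣ s ∣ ∉ map ∣_∣ l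
  ∣s∣∉ ∣s∣∈ with ∈-map⁻ ∣_∣ ∣s∣∈
  ... | y , y∈ , eq = All.lookup (no-new-letter (len , letters , u)) y∈ (trans (sym eq) (abs-new m s∈))

-- Pigeonhole: an element of B_{m+1} contains a letter of absolute value m+1,
-- since otherwise its m+1 distinct absolute values would lie in {1,...,m}.
new-letter-occurs : ∀ m {l} → IsSignedPerm (suc m) l → Any (λ x → ∣ x ∣ ≡ suc m) l
new-letter-occurs m {l} (len , letters , u) with any? (λ x → ∣ x ∣ ≟ℕ suc m) l
... | yes found = found
... | no none = ⊥-elim (<-irrefl refl (subst (_≤ m) len (begin
  length l                ≡⟨ List.length-map ∣_∣ l ⟨
  length (map ∣_∣ l)      ≤⟨ length-mono-⊆ _≟ℕ_ u (Unique.map⁺ suc-toℕ-injective (Unique.allFin⁺ m)) ⊆small ⟩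
  length (map small (allFin m)) ≡⟨ trans (List.length-map small (allFin m)) (List.length-tabulate (λ i → i)) ⟩
  m                       ∎)))
  where
  open ≤-Reasoning
  small : Fin m → ℕ
  small i = suc (toℕ i)
  ⊆small : ∀ {z} → z ∈ map ∣_∣ l → z ∈ map small (allFin m)
  ⊆small z∈ with ∈-map⁻ ∣_∣ z∈
  ... | x , x∈ , refl with isLetter-pred (All.lookup letters x∈) (All.lookup (¬Any⇒All¬ l none) x∈)
  ... | (b , i) , refl = subst (_∈ map small (allFin m)) (sym (abs-value (b , i))) (∈-map⁺ small (∈-allFin i))

remove-new-letter : ∀ m {l} → IsSignedPerm (suc m) l → Σ (List ℤ) λ l′ → Σ ℕ λ j → Σ ℤ λ s →
  l ≡ insert l′ j s × IsSignedPerm m l′ × j < suc m × s ∈ newLetters m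
remove-new-letter m {l} perm@(len , letters , u) with insert-decompose (new-letter-occurs m perm)
... | j , s , l′ , refl , ∣s∣≡ , j≤ =
  l′ , j , s , refl , (len′ , letters′ , proj₁ abs-unique) , s≤s (subst (j ≤_) len′ j≤) , abs≡suc⇒new m ∣s∣≡
  where
  len′ : length l′ ≡ m
  len′ = suc-injective (trans (sym (length-insert l′ j s)) len)
  abs-unique : Unique (map ∣_∣ l′) × ∣ s ∣ ∉ map ∣_∣ l′
  abs-unique = unique-insert⁻ (map ∣_∣ l′) j (subst Unique (map-insert ∣_∣ l′ j s) u)
  letters′ : All (IsLetter m) l′
  letters′ = All.tabulate λ {y} y∈ → isLetter-pred (All.lookup (proj₁ (All-insert⁻ l′ j letters)) y∈)
    (λ ∣y∣≡ → proj₂ abs-unique (subst (_∈ map ∣_∣ l′) (trans ∣y∣≡ (sym ∣s∣≡)) (∈-map⁺ ∣_∣ y∈)))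

children : ℕ → List ℤ → List (List ℤ)
children m l = concatMap (λ j → map (insert l j) (newLetters m)) (upTo (suc m))

extensions : ℕ → List (List ℤ)
extensions m = concatMap (children m) (signedWords m)

∈-children⁻ : ∀ m l {z} → z ∈ children m l →
  Σ ℕ λ j → Σ ℤ λ s → j < suc m × s ∈ newLetters m × z ≡ insert l j s
∈-children⁻ m l z∈ with find (∈-concatMap⁻ (λ j → map (insert l j) (newLetters m)) z∈)
... | j , j∈ , z∈′ with ∈-map⁻ (insert l j) z∈′
... | s , s∈ , eq = j , s , ∈-upTo⁻ j∈ , s∈ , eq

∈-children⁺ : ∀ m l {j s} → j < suc m → s ∈ newLetters m → insert l j s ∈ children m l
∈-children⁺ m l j< s∈ = ∈-concatMap⁺ (λ j → map (insert l j) (newLetters m)) (lose (∈-upTo⁺ j<) (∈-map⁺ (insert l _) s∈))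

insert-new-injective : ∀ m {l l′ j j′ s s′} → IsSignedPerm m l → IsSignedPerm m l′ →
  j < suc m → j′ < suc m → s ∈ newLetters m → s′ ∈ newLetters m →
  insert l j s ≡ insert l′ j′ s′ → l ≡ l′ × j ≡ j′
insert-new-injective m {l} {l′} {j} {j′} perm perm′ (s≤s j≤) (s≤s j′≤) s∈ s′∈ =
  insert-injective (λ x → ∣ x ∣ ≡ suc m) l l′ j j′ (abs-new m s∈) (abs-new m s′∈)
    (no-new-letter perm) (no-new-letter perm′)
    (subst (j ≤_) (sym (proj₁ perm)) j≤) (subst (j′ ≤_) (sym (proj₁ perm′)) j′≤)

children-unique : ∀ m {l} → IsSignedPerm m l → Unique (children m l)
children-unique m {l} perm =
  unique-concatMap (λ j → map (insert l j) (newLetters m)) (upTo (suc m)) (Unique.upTo⁺ (suc m))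
    (λ {j} _ → Unique.map⁺ (insert-injectiveʳ l j) (newLetters-unique m))
    (λ {j} {j′} j∈ j′∈ z∈ z∈′ →
      let (s , s∈ , eq) = ∈-map⁻ (insert l j) z∈ ; (s′ , s′∈ , eq′) = ∈-map⁻ (insert l j′) z∈′
      in proj₂ (insert-new-injective m perm perm (∈-upTo⁻ j∈) (∈-upTo⁻ j′∈) s∈ s′∈ (trans (sym eq) eq′)))

extensions-unique : ∀ m → Unique (extensions m)
extensions-unique m =
  unique-concatMap (children m) (signedWords m) (signedWords-unique m)
    (λ l∈ → children-unique m (signedWords-sound m l∈))
    (λ l∈ l′∈ z∈ z∈′ →
      let (j , s , j< , s∈ , eq) = ∈-children⁻ m _ z∈ ; (j′ , s′ , j′< , s′∈ , eq′) = ∈-children⁻ m _ z∈′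
      in proj₁ (insert-new-injective m (signedWords-sound m l∈) (signedWords-sound m l′∈) j< j′< s∈ s′∈ (trans (sym eq) eq′)))

-- The central bijection B_{m+1} ≅ B_m × {positions 0..m} × {±(m+1)}, in
-- the form that both lists have the same counts for every statistic.
count-signedWords-suc : ∀ m (f : List ℤ → Bool) → count f (signedWords (suc m)) ≡ count f (extensions m)
count-signedWords-suc m f =
  count-same-elements f (signedWords-unique (suc m)) (extensions-unique m) ⊆extensions ⊆signedWords
  where
  ⊆extensions : ∀ {z} → z ∈ signedWords (suc m) → z ∈ extensions m
  ⊆extensions z∈ with remove-new-letter m (signedWords-sound (suc m) z∈)
  ... | l′ , j , s , refl , perm , j< , s∈ =
    ∈-concatMap⁺ (children m) (lose (signedWords-complete m perm) (∈-children⁺ m l′ j< s∈))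
  ⊆signedWords : ∀ {z} → z ∈ extensions m → z ∈ signedWords (suc m)
  ⊆signedWords z∈ with find (∈-concatMap⁻ (children m) z∈)
  ... | l , l∈ , z∈children with ∈-children⁻ m l z∈children
  ... | j , s , _ , s∈ , refl = signedWords-complete (suc m) (insert-new-signedPerm m j (signedWords-sound m l∈) s∈)

descents : List ℤ → ℕ
descents l = descList (pos 0 ∷ l)

hasStat : ℕ → ℕ → List ℤ → Bool
hasStat e k l = does (negatives l % 2 ≟ℕ e) ∧ does (descents l ≟ℕ k)

-- D and D̃ with the parity class e as a parameter: D = Dₚ 0, D̃ = Dₚ 1.
Dₚ : ℕ → ℕ → ℕ → ℕ
Dₚ e n k = length (filter (λ w → (negs w % 2 ≟ℕ e) ×-dec (desc w ≟ℕ k)) (B n))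

Dₚ≡count : ∀ e n k → Dₚ e n k ≡ count (hasStat e k) (signedWords n)
Dₚ≡count e n k = begin
  Dₚ e n k
    ≡⟨ length-filter≡count (λ w → (negs w % 2 ≟ℕ e) ×-dec (desc w ≟ℕ k)) (B n) ⟩
  count (λ w → does (negs w % 2 ≟ℕ e) ∧ does (desc w ≟ℕ k)) (B n)
    ≡⟨ count-cong (B n) (λ {w} _ → cong (λ t → does (t % 2 ≟ℕ e) ∧ does (desc w ≟ℕ k)) (negs≡negatives w)) ⟩
  count (λ w → hasStat e k (wordOf w)) (B n)
    ≡⟨ count-map (hasStat e k) wordOf (B n) ⟨
  count (hasStat e k) (signedWords n) ∎
  where open ≡-Reasoning

FlipsParity : ℕ → ℕ → Set
FlipsParity e e′ = ∀ p → does (suc p % 2 ≟ℕ e) ≡ does (p % 2 ≟ℕ e′)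

flips-0-1 : FlipsParity 0 1
flips-0-1 0             = refl
flips-0-1 1             = refl
flips-0-1 (suc (suc p)) = flips-0-1 p

flips-1-0 : FlipsParity 1 0
flips-1-0 0             = refl
flips-1-0 1             = refl
flips-1-0 (suc (suc p)) = flips-1-0 p

-- How the children of one element l of B_m contribute to the count of
-- class e with k descents; the parity of a child inserted with -(m+1)
-- is that of class e′ for l.
module ChildCount (m e e′ k : ℕ) (flip : FlipsParity e e′) where

  matchAt : ℕ → List ℤ → ℕ → ℕ
  matchAt p l x = ind (does (negatives l % 2 ≟ℕ p) ∧ does (x ≟ℕ k))

  -- With d = desc l: d+1 positions for +(m+1) keep d descents, m-d raise
  -- them; d positions for -(m+1) keep them, m-d+1 raise them.
  childCount : List ℤ → ℕ
  childCount l = suc d * matchAt e l d + (m ∸ d) * matchAt e l (suc d)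
               + d * matchAt e′ l d + suc (m ∸ d) * matchAt e′ l (suc d)
    where
    d : ℕ
    d = descents l

  child-contribution : ∀ {l} → IsSignedPerm m l → ∀ j →
    count (hasStat e k) (map (insert l j) (newLetters m))
      ≡ matchAt e l (descents l + ind (ascentAt (pos 0 ∷ l) j))
        + matchAt e′ l (descents l + ind (ascentOrEndAt (pos 0 ∷ l) j))
  child-contribution {l} perm@(_ , letters , _) j = cong₂ _+_
    (cong ind (cong₂ _∧_
      (cong (λ t → does (t % 2 ≟ℕ e)) (count-insert isNeg l j (pos (suc m))))
      (cong (λ t → does (t ≟ℕ k))
        (descents-insert-max (pos 0) l (pos (suc m)) j below-top (unique-with-0 perm)))))
    (trans (+-identityʳ _) (cong ind (cong₂ _∧_
      (trans (cong (λ t → does (t % 2 ≟ℕ e)) (count-insert isNeg l j -[1+ m ])) (flip (negatives l)))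
      (cong (λ t → does (t ≟ℕ k))
        (descents-insert-min (pos 0) l -[1+ m ] j above-bottom (unique-with-0 perm))))))
    where
    below-top : All (ℤ._< pos (suc m)) (pos 0 ∷ l)
    below-top = ℤ.+<+ (s≤s z≤n) ∷ All.map isLetter-<top letters
    above-bottom : All (-[1+ m ] ℤ.<_) (pos 0 ∷ l)
    above-bottom = ℤ.-<+ ∷ All.map isLetter->bottom letters

  count-children : ∀ {l} → IsSignedPerm m l → count (hasStat e k) (children m l) ≡ childCount l
  count-children {l} perm = begin
    count (hasStat e k) (children m l)
      ≡⟨ count-concatMap (hasStat e k) (λ j → map (insert l j) (newLetters m)) P ⟩
    sumOver (λ j → count (hasStat e k) (map (insert l j) (newLetters m))) P
      ≡⟨ sumOver-cong P (λ {j} _ → child-contribution perm j) ⟩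
    sumOver (λ j → byMax j + byMin j) P
      ≡⟨ sumOver-+ byMax byMin P ⟩
    sumOver byMax P + sumOver byMin P
      ≡⟨ cong₂ _+_ (sumOver-step (matchAt e l) (ascentAt L) d P)
                   (sumOver-step (matchAt e′ l) (ascentOrEndAt L) d P) ⟩
    (count (λ j → not (ascentAt L j)) P * matchAt e l d + count (ascentAt L) P * matchAt e l (suc d))
    + (count (λ j → not (ascentOrEndAt L j)) P * matchAt e′ l d + count (ascentOrEndAt L) P * matchAt e′ l (suc d))
      ≡⟨ cong₂ _+_ (cong₂ _+_ (cong (_* matchAt e l d) max-keeps) (cong (_* matchAt e l (suc d)) max-raises))
                   (cong₂ _+_ (cong (_* matchAt e′ l d) min-keeps) (cong (_* matchAt e′ l (suc d)) min-raises)) ⟩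
    (suc d * matchAt e l d + (m ∸ d) * matchAt e l (suc d))
    + (d * matchAt e′ l d + suc (m ∸ d) * matchAt e′ l (suc d))
      ≡⟨ +-assoc (suc d * matchAt e l d + (m ∸ d) * matchAt e l (suc d)) _ _ ⟨
    childCount l ∎
    where
    open ≡-Reasoning
    L : List ℤ
    L = pos 0 ∷ l
    d : ℕ
    d = descents l
    P : List ℕ
    P = upTo (suc m)
    byMax byMin : ℕ → ℕ
    byMax j = matchAt e l (d + ind (ascentAt L j))
    byMin j = matchAt e′ l (d + ind (ascentOrEndAt L j))
    open InsertionProfile (subst (λ n → InsertionProfile L n d) (proj₁ perm)
                            (insertionProfile (pos 0) l (unique-with-0 perm)))

  count-signedWords-step : count (hasStat e k) (signedWords (suc m)) ≡ sumOver childCount (signedWords m)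
  count-signedWords-step = begin
    count (hasStat e k) (signedWords (suc m))
      ≡⟨ count-signedWords-suc m (hasStat e k) ⟩
    count (hasStat e k) (extensions m)
      ≡⟨ count-concatMap (hasStat e k) (children m) (signedWords m) ⟩
    sumOver (λ l → count (hasStat e k) (children m l)) (signedWords m)
      ≡⟨ sumOver-cong (signedWords m) (λ l∈ → count-children (signedWords-sound m l∈)) ⟩
    sumOver childCount (signedWords m) ∎
    where open ≡-Reasoning

weight-at-match : (c : ℕ → ℕ) (b : Bool) (d k : ℕ) →
  c d * ind (b ∧ does (d ≟ℕ k)) ≡ c k * ind (b ∧ does (d ≟ℕ k))
weight-at-match c b d k = at (d ≟ℕ k)
  where
  at : (d≟k : Dec (d ≡ k)) → c d * ind (b ∧ does d≟k) ≡ c k * ind (b ∧ does d≟k)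
  at (yes refl) = refl
  at (no _)     = trans (vanishes (c d)) (sym (vanishes (c k)))
    where
    vanishes : ∀ n → n * ind (b ∧ false) ≡ 0
    vanishes n = trans (cong (λ x → n * ind x) (∧-zeroʳ b)) (*-zeroʳ n)

-- The recurrence of Theorem 4.2 for parity class e, in the variables
-- n = m+1 and k = k′+1.
Dₚ-step : ∀ m e e′ k′ → FlipsParity e e′ →
  Dₚ e (suc m) (suc k′) ≡ suc (suc k′) * Dₚ e m (suc k′) + (m ∸ k′) * Dₚ e m k′
                          + suc k′ * Dₚ e′ m (suc k′) + suc (m ∸ k′) * Dₚ e′ m k′
Dₚ-step m e e′ k′ flip = begin
  Dₚ e (suc m) (suc k′)
    ≡⟨ Dₚ≡count e (suc m) (suc k′) ⟩
  count (hasStat e (suc k′)) (signedWords (suc m))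
    ≡⟨ count-signedWords-step ⟩
  sumOver childCount (signedWords m)
    ≡⟨ sumOver-cong (signedWords m) (λ {l} _ → childCount-at l) ⟩
  sumOver (λ l → c₁ * ind (hasStat e (suc k′) l) + c₂ * ind (hasStat e k′ l)
               + c₃ * ind (hasStat e′ (suc k′) l) + c₄ * ind (hasStat e′ k′ l)) (signedWords m)
    ≡⟨ sumOver-linear₄ c₁ c₂ c₃ c₄ (hasStat e (suc k′)) (hasStat e k′) (hasStat e′ (suc k′)) (hasStat e′ k′) (signedWords m) ⟩
  c₁ * count (hasStat e (suc k′)) (signedWords m) + c₂ * count (hasStat e k′) (signedWords m)
  + c₃ * count (hasStat e′ (suc k′)) (signedWords m) + c₄ * count (hasStat e′ k′) (signedWords m)
    ≡⟨ cong₂ _+_ (cong₂ _+_ (cong₂ _+_ (cong (c₁ *_) (Dₚ≡count e m (suc k′))) (cong (c₂ *_) (Dₚ≡count e m k′)))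
                            (cong (c₃ *_) (Dₚ≡count e′ m (suc k′)))) (cong (c₄ *_) (Dₚ≡count e′ m k′)) ⟨
  c₁ * Dₚ e m (suc k′) + c₂ * Dₚ e m k′ + c₃ * Dₚ e′ m (suc k′) + c₄ * Dₚ e′ m k′ ∎
  where
  open ≡-Reasoning
  open ChildCount m e e′ (suc k′) flip
  c₁ c₂ c₃ c₄ : ℕ
  c₁ = suc (suc k′)
  c₂ = m ∸ k′
  c₃ = suc k′
  c₄ = suc (m ∸ k′)
  childCount-at : ∀ l → childCount l ≡ c₁ * ind (hasStat e (suc k′) l) + c₂ * ind (hasStat e k′ l)
                                       + c₃ * ind (hasStat e′ (suc k′) l) + c₄ * ind (hasStat e′ k′ l)
  childCount-at l = cong₂ _+_ (cong₂ _+_ (cong₂ _+_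
    (weight-at-match suc (does (negatives l % 2 ≟ℕ e)) (descents l) (suc k′))
    (weight-at-match (m ∸_) (does (negatives l % 2 ≟ℕ e)) (descents l) k′))
    (weight-at-match (λ t → t) (does (negatives l % 2 ≟ℕ e′)) (descents l) (suc k′)))
    (weight-at-match (λ t → suc (m ∸ t)) (does (negatives l % 2 ≟ℕ e′)) (descents l) k′)

-- No child of l gains a descent when k = 0 is asked for, so column 0 is
-- constant: only the children keeping 0 descents with +(m+1) count.
Dₚ-step-zero : ∀ m e e′ → FlipsParity e e′ → Dₚ e (suc m) 0 ≡ Dₚ e m 0
Dₚ-step-zero m e e′ flip = begin
  Dₚ e (suc m) 0
    ≡⟨ Dₚ≡count e (suc m) 0 ⟩
  count (hasStat e 0) (signedWords (suc m))
    ≡⟨ count-signedWords-step ⟩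
  sumOver childCount (signedWords m)
    ≡⟨ sumOver-cong (signedWords m) (λ {l} _ → childCount-at l) ⟩
  sumOver (λ l → 1 * ind (hasStat e 0 l)) (signedWords m)
    ≡⟨ sumOver-scale 1 (hasStat e 0) (signedWords m) ⟩
  1 * count (hasStat e 0) (signedWords m)
    ≡⟨ *-identityˡ _ ⟩
  count (hasStat e 0) (signedWords m)
    ≡⟨ Dₚ≡count e m 0 ⟨
  Dₚ e m 0 ∎
  where
  open ≡-Reasoning
  open ChildCount m e e′ 0 flip
  childCount-at : ∀ l → childCount l ≡ 1 * ind (hasStat e 0 l)
  childCount-at l = begin
    childCount l
      ≡⟨ cong₂ _+_ (cong₂ _+_ (cong₂ _+_
           (weight-at-match suc (does (negatives l % 2 ≟ℕ e)) (descents l) 0)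
           (cong (λ b → (m ∸ descents l) * ind b) (∧-zeroʳ (does (negatives l % 2 ≟ℕ e)))))
           (weight-at-match (λ t → t) (does (negatives l % 2 ≟ℕ e′)) (descents l) 0))
           (cong (λ b → suc (m ∸ descents l) * ind b) (∧-zeroʳ (does (negatives l % 2 ≟ℕ e′)))) ⟩
    1 * ind (hasStat e 0 l) + (m ∸ descents l) * 0 + 0 + suc (m ∸ descents l) * 0
      ≡⟨ cong₂ _+_ (cong (_+ 0) (trans (cong (1 * ind (hasStat e 0 l) +_) (*-zeroʳ (m ∸ descents l))) (+-identityʳ _)))
                   (*-zeroʳ (suc (m ∸ descents l))) ⟩
    1 * ind (hasStat e 0 l) + 0 + 0
      ≡⟨ trans (+-identityʳ _) (+-identityʳ _) ⟩
    1 * ind (hasStat e 0 l) ∎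

-- An element of B_m has at most m descents.
Dₚ-above-size : ∀ e m → Dₚ e m (suc m) ≡ 0
Dₚ-above-size e m = trans (Dₚ≡count e m (suc m))
  (trans (count-cong (signedWords m) (λ l∈ → not-stat (signedWords-sound m l∈))) (count-false (signedWords m)))
  where
  not-stat : ∀ {l} → IsSignedPerm m l → hasStat e (suc m) l ≡ false
  not-stat {l} perm = trans (cong (does (negatives l % 2 ≟ℕ e) ∧_) (dec-false (descents l ≟ℕ suc m) too-many))
                            (∧-zeroʳ (does (negatives l % 2 ≟ℕ e)))
    where
    at-most-m : descents l ≤ m
    at-most-m = subst (descents l ≤_) (trans (ascents+descents (pos 0) l (unique-with-0 perm)) (proj₁ perm))
                      (m≤n+m _ _)
    too-many : descents l ≢ suc m
    too-many eq = <-irrefl refl (subst (_≤ m) eq at-most-m)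

-- On the diagonal only the term D(m,m) of the opposite class survives.
Dₚ-diagonal-step : ∀ m e e′ → FlipsParity e e′ → Dₚ e (suc m) (suc m) ≡ Dₚ e′ m m
Dₚ-diagonal-step m e e′ flip = begin
  Dₚ e (suc m) (suc m)
    ≡⟨ Dₚ-step m e e′ m flip ⟩
  suc (suc m) * Dₚ e m (suc m) + (m ∸ m) * Dₚ e m m + suc m * Dₚ e′ m (suc m) + suc (m ∸ m) * Dₚ e′ m m
    ≡⟨ cong₂ (λ a b → suc (suc m) * a + (m ∸ m) * Dₚ e m m + suc m * b + suc (m ∸ m) * Dₚ e′ m m)
             (Dₚ-above-size e m) (Dₚ-above-size e′ m) ⟩
  suc (suc m) * 0 + (m ∸ m) * Dₚ e m m + suc m * 0 + suc (m ∸ m) * Dₚ e′ m m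
    ≡⟨ cong (λ t → suc (suc m) * 0 + t * Dₚ e m m + suc m * 0 + suc t * Dₚ e′ m m) (n∸n≡0 m) ⟩
  suc (suc m) * 0 + 0 * Dₚ e m m + suc m * 0 + 1 * Dₚ e′ m m
    ≡⟨ cong₂ (λ a b → a + 0 * Dₚ e m m + b + 1 * Dₚ e′ m m) (*-zeroʳ (suc (suc m))) (*-zeroʳ (suc m)) ⟩
  0 + 0 * Dₚ e m m + 0 + 1 * Dₚ e′ m m
    ≡⟨ *-identityˡ _ ⟩
  Dₚ e′ m m ∎
  where open ≡-Reasoning

diagonal : ∀ n → Dₚ 0 n n ≡ ind (does (n % 2 ≟ℕ 0)) × Dₚ 1 n n ≡ ind (does (n % 2 ≟ℕ 1))
diagonal zero    = refl , refl
diagonal (suc m) =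
  trans (Dₚ-diagonal-step m 0 1 flips-0-1) (trans (proj₂ (diagonal m)) (cong ind (sym (flips-0-1 m)))) ,
  trans (Dₚ-diagonal-step m 1 0 flips-1-0) (trans (proj₁ (diagonal m)) (cong ind (sym (flips-1-0 m))))

column-zero : ∀ e e′ → FlipsParity e e′ → ∀ n → Dₚ e n 0 ≡ Dₚ e 0 0
column-zero e e′ flip zero    = refl
column-zero e e′ flip (suc m) = trans (Dₚ-step-zero m e e′ flip) (column-zero e e′ flip m)

recurrence : ∀ e e′ → FlipsParity e e′ → (n k : ℕ) → 0 < k → k < n →
  Dₚ e n k ≡ (k + 1) * Dₚ e (n ∸ 1) k + (n ∸ k) * Dₚ e (n ∸ 1) (k ∸ 1)
           + k * Dₚ e′ (n ∸ 1) k + (n ∸ k + 1) * Dₚ e′ (n ∸ 1) (k ∸ 1)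
recurrence e e′ flip n       zero     () _
recurrence e e′ flip zero    (suc k′) _  ()
recurrence e e′ flip (suc m) (suc k′) _  _  =
  trans (Dₚ-step m e e′ k′ flip)
        (cong₂ (λ a b → a * Dₚ e m (suc k′) + (m ∸ k′) * Dₚ e m k′ + suc k′ * Dₚ e′ m (suc k′) + b * Dₚ e′ m k′)
               (+-comm 1 (suc k′)) (+-comm 1 (m ∸ k′)))

theorem4p2 :
    ((n k : ℕ) → 0 < k → k < n →
      D n k ≡ (k + 1) * D (n ∸ 1) k + (n ∸ k) * D (n ∸ 1) (k ∸ 1)
              + k * D̃ (n ∸ 1) k + (n ∸ k + 1) * D̃ (n ∸ 1) (k ∸ 1))
    × ((n k : ℕ) → 0 < k → k < n →
      D̃ n k ≡ (k + 1) * D̃ (n ∸ 1) k + (n ∸ k) * D̃ (n ∸ 1) (k ∸ 1)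
              + k * D (n ∸ 1) k + (n ∸ k + 1) * D (n ∸ 1) (k ∸ 1))
    × ((n : ℕ) → D n 0 ≡ 1)
    × ((n : ℕ) → D̃ n 0 ≡ 0)
    × ((n : ℕ) → n % 2 ≡ 0 → D n n ≡ 1)
    × ((n : ℕ) → n % 2 ≡ 1 → D n n ≡ 0)
    × ((n : ℕ) → n % 2 ≡ 0 → D̃ n n ≡ 0)
    × ((n : ℕ) → n % 2 ≡ 1 → D̃ n n ≡ 1)
theorem4p2 =
  recurrence 0 1 flips-0-1 ,
  recurrence 1 0 flips-1-0 ,
  column-zero 0 1 flips-0-1 ,
  column-zero 1 0 flips-1-0 ,
  (λ n even → trans (proj₁ (diagonal n)) (cong (λ r → ind (does (r ≟ℕ 0))) even)) ,
  (λ n odd  → trans (proj₁ (diagonal n)) (cong (λ r → ind (does (r ≟ℕ 0))) odd)) ,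
  (λ n even → trans (proj₂ (diagonal n)) (cong (λ r → ind (does (r ≟ℕ 1))) even)) ,
  (λ n odd  → trans (proj₂ (diagonal n)) (cong (λ r → ind (does (r ≟ℕ 1))) odd))
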